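{- Let $G$ be a connected claw-free graph of even order, and let $P:u_1\ldots u_k$ be a path in $G$ (with last vertex $u_k$) that allows neither an end-extension nor a swap-extension. Then the edge $u_{k-1}u_k$ belongs to some perfect matching of $G$.
   Context: A graph is claw-free if it has no induced $K_{1,3}$. For a path $P:u_1\ldots u_k$ in $G$, whose last vertex is $u_k$: $P$ allows an end-extension if $u_k$ has a neighbor $v$ not lying on $P$ (the extension being the path $u_1\ldots u_kv$); $P$ allows a swap-extension if $k\geq 3$, $u_{k-2}$ is adjacent to $u_k$, and $u_{k-1}$ has a neighbor $v$ not lying on $P$ (the extension being the path $u_1\ldots u_{k-2}u_ku_{k-1}v$). -}

module Defs where

open import Data.Nat using (ℕ)
open import Data.Fin using (Fin)
open import Data.List using (List; []; _∷_; _++_)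
open import Data.List.Membership.Propositional using (_∈_; _∉_)
open import Data.List.Relation.Unary.Unique.Propositional using (Unique)
open import Data.List.Relation.Unary.Linked using (Linked)
open import Data.Product using (Σ; ∃; ∃-syntax; _×_)
open import Relation.Nullary using (¬_; Dec)
open import Relation.Binary.PropositionalEquality using (_≡_)
open import Relation.Binary.Construct.Closure.ReflexiveTransitive using (Star)

record Graph (n : ℕ) : Set₁ where
  field
    Adj   : Fin n → Fin n → Set
    sym   : ∀ {u v} → Adj u v → Adj v u
    irrefl : ∀ {u} → ¬ Adj u u
    dec   : ∀ u v → Dec (Adj u v)

module _ {n : ℕ} (G : Graph n) where
  open Graph G

  Connected : Set
  Connected = ∀ u v → Star Adj u v

  ClawFree : Set
  ClawFree = ¬ (Σ (Fin n) λ c → Σ (Fin n) λ a → Σ (Fin n) λ b → Σ (Fin n) λ d →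
      Adj c a × Adj c b × Adj c d ×
      ¬ a ≡ b × ¬ a ≡ d × ¬ b ≡ d ×
      ¬ Adj a b × ¬ Adj a d × ¬ Adj b d)

  IsPath : List (Fin n) → Set
  IsPath P = Unique P × Linked Adj P

  -- P allows an end-extension, where y is the last vertex of P
  EndExtension : List (Fin n) → Fin n → Set
  EndExtension P y = ∃[ v ] (Adj y v × v ∉ P)

  -- P = ps ++ x ∷ y ∷ [] allows a swap-extension:
  -- k ≥ 3, u_{k-2} adjacent to u_k = y, and u_{k-1} = x has a neighbour off P
  SwapExtension : List (Fin n) → Fin n → Fin n → Set
  SwapExtension ps x y =
    Σ (List (Fin n)) λ qs → Σ (Fin n) λ w →
      ps ≡ qs ++ w ∷ [] × Adj w y × ∃[ v ] (Adj x v × v ∉ ps ++ x ∷ y ∷ [])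

  record PerfectMatching : Set₁ where
    field
      M        : Fin n → Fin n → Set
      M⊆E      : ∀ {u v} → M u v → Adj u v
      M-sym    : ∀ {u v} → M u v → M v u
      covered  : ∀ u → ∃[ v ] M u v
      unique   : ∀ {u v w} → M u v → M u w → v ≡ w

module Submission where

-- Call a path with last two vertices x, y and remaining vertex
-- set R "stuck" (relative to a vertex set S) if it allows neither an
-- end-extension nor a swap-extension inside S.  The heart of the argument
-- (Sumner's argument for claw-free graphs) is the removal lemma
-- 'connected-after-removal': deleting x and y from a connected claw-free
-- induced subgraph leaves it connected.  Every remaining vertex walks towards
-- x until it first meets an "anchor" (a vertex on R or adjacent to x), and
-- claw-freeness at x joins all anchors to each other.

open import Defs
open import Data.Nat using (ℕ; zero; suc; _+_; _*_; _≤_; _<_; z≤n; s≤s)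
open import Data.Nat.Properties using (≤-trans; ≤-reflexive; n≤1+n; 1+n≰n; +-suc; +-identityʳ; suc-injective)
open import Data.Nat.Divisibility using (_∣_; divides)
open import Data.Fin using (Fin; _≟_)
open import Data.Fin.Properties using (¬Fin0)
open import Data.List using (List; []; _∷_; _++_; _∷ʳ_; length; filter; allFin; initLast; _∷ʳ′_)
open import Data.List.Properties using (length-tabulate; filter-accept; filter-reject; filter-all; filter-notAll; ++-assoc)
open import Data.List.Membership.Propositional using (_∈_; _∉_; find; lose)
open import Data.List.Membership.Propositional.Properties using (∈-filter⁺; ∈-filter⁻; ∈-allFin; ∈-++⁻; ∈-++⁺ʳ)
open import Data.List.Membership.DecPropositional using () renaming (_∈?_ to member?)
open import Data.List.Relation.Unary.Any as Any using (here; there; any?)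
open import Data.List.Relation.Unary.All as All using (All; []; _∷_)
open import Data.List.Relation.Unary.Any.Properties using (¬Any[])
open import Data.List.Relation.Unary.All.Properties using (All¬⇒¬Any; ¬Any⇒All¬)
open import Data.List.Relation.Unary.AllPairs using ([]; _∷_)
open import Data.List.Relation.Unary.Unique.Propositional using (Unique)
open import Data.List.Relation.Unary.Unique.Propositional.Properties using (filter⁺; allFin⁺)
open import Data.List.Relation.Unary.Linked as Linked using (Linked; []; [-]; _∷_)
open import Data.Product using (Σ; ∃-syntax; _×_; _,_; proj₁; proj₂)
open import Data.Sum using (_⊎_; inj₁; inj₂; [_,_]; [_,_]′)
open import Data.Empty using (⊥; ⊥-elim)
open import Function using (_∘_; id)
open import Relation.Nullary using (¬_; Dec; yes; no)
open import Relation.Nullary.Decidable using (¬?; _×-dec_; decidable-stable)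
open import Relation.Binary.Definitions using (DecidableEquality)
open import Relation.Binary.PropositionalEquality using (_≡_; _≢_; refl; sym; trans; subst; cong; module ≡-Reasoning)
open import Relation.Binary.Construct.Closure.ReflexiveTransitive using (Star; ε; _◅_; _◅◅_)
import Relation.Binary.Construct.Closure.ReflexiveTransitive as Star

unique-++-disjoint : ∀ {A : Set} xs {ys : List A} {a} → Unique (xs ++ ys) → a ∈ xs → a ∉ ys
unique-++-disjoint (z ∷ xs) (z∉ ∷ _) (here refl) a∈ys = All.lookup z∉ (∈-++⁺ʳ xs a∈ys) refl
unique-++-disjoint (z ∷ xs) (_ ∷ u) (there a∈xs) a∈ys = unique-++-disjoint xs u a∈xs a∈ys

∈-path⁻ : ∀ {A : Set} ps {x y v : A} → v ∈ ps ++ x ∷ y ∷ [] → v ∈ ps ⊎ v ≡ x ⊎ v ≡ y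
∈-path⁻ ps v∈P with ∈-++⁻ ps v∈P
... | inj₁ v∈ps = inj₁ v∈ps
... | inj₂ (here v≡x) = inj₂ (inj₁ v≡x)
... | inj₂ (there (here v≡y)) = inj₂ (inj₂ v≡y)

∉-swap : ∀ {A : Set} {v a b : A} {zs} → v ∉ a ∷ b ∷ zs → v ∉ b ∷ a ∷ zs
∉-swap v∉ (here v≡b) = v∉ (there (here v≡b))
∉-swap v∉ (there (here v≡a)) = v∉ (here v≡a)
∉-swap v∉ (there (there v∈zs)) = v∉ (there (there v∈zs))

linked-prefix : ∀ {A : Set} {R : A → A → Set} ps {zs : List A} → Linked R (ps ++ zs) → Linked R ps
linked-prefix [] _ = []
linked-prefix (p ∷ []) _ = [-]
linked-prefix (p ∷ q ∷ ps) (r ∷ l) = r ∷ linked-prefix (q ∷ ps) l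

linked-at : ∀ {A : Set} {R : A → A → Set} qs {a b : A} {zs} → Linked R (qs ++ a ∷ b ∷ zs) → R a b
linked-at [] l = Linked.head l
linked-at (q ∷ qs) l = linked-at qs (Linked.tail l)

module Removal {A : Set} (_≟ᴬ_ : DecidableEquality A) where

  ≢? : ∀ x v → Dec (v ≢ x)
  ≢? x v = ¬? (v ≟ᴬ x)

  remove : A → List A → List A
  remove x = filter (≢? x)

  ∈-remove⁺ : ∀ {x v S} → v ∈ S → v ≢ x → v ∈ remove x S
  ∈-remove⁺ {x} = ∈-filter⁺ (≢? x)

  ∈-remove⁻ : ∀ {x v S} → v ∈ remove x S → v ∈ S × v ≢ x
  ∈-remove⁻ {x} = ∈-filter⁻ (≢? x)

  remove-unique : ∀ {x S} → Unique S → Unique (remove x S)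
  remove-unique {x} = filter⁺ (≢? x)

  remove-shorter : ∀ {x S} → x ∈ S → length (remove x S) < length S
  remove-shorter {x} {S} x∈S =
    filter-notAll (≢? x) S (Any.map (λ x≡v v≢x → v≢x (sym x≡v)) x∈S)

  length-remove : ∀ {x S} → Unique S → x ∈ S → suc (length (remove x S)) ≡ length S
  length-remove {x} {.x ∷ S} (x∉S ∷ _) (here refl) =
    cong (suc ∘ length)
      (trans (filter-reject (≢? x) (λ x≢x → x≢x refl))
             (filter-all (≢? x) (All.map (λ x≢v v≡x → x≢v (sym v≡x)) x∉S)))
  length-remove {x} {v ∷ S} (v∉S ∷ uS) (there x∈S) =
    cong suc (trans (cong length (filter-accept (≢? x) (All.lookup v∉S x∈S)))
                    (length-remove uS x∈S))

  unique-⊆-length : ∀ {P S} → Unique P → All (_∈ S) P → length P ≤ length S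
  unique-⊆-length [] [] = z≤n
  unique-⊆-length {p ∷ P} {S} (p∉P ∷ uP) (p∈S ∷ P⊆S) =
    ≤-trans (s≤s (unique-⊆-length uP P⊆S∖p)) (remove-shorter p∈S)
    where
    P⊆S∖p : All (_∈ remove p S) P
    P⊆S∖p = All.zipWith (λ (p≢q , q∈S) → ∈-remove⁺ q∈S (p≢q ∘ sym)) (p∉P , P⊆S)

  remove₂ : A → A → List A → List A
  remove₂ x y S = remove y (remove x S)

  ∈-remove₂⁺ : ∀ {x y v S} → v ∈ S → v ≢ x → v ≢ y → v ∈ remove₂ x y S
  ∈-remove₂⁺ v∈S v≢x v≢y = ∈-remove⁺ (∈-remove⁺ v∈S v≢x) v≢y

  ∈-remove₂⁻ : ∀ x y S {v} → v ∈ remove₂ x y S → v ∈ S × v ≢ x × v ≢ y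
  ∈-remove₂⁻ _ _ _ v∈ with ∈-remove⁻ v∈
  ... | v∈S∖x , v≢y with ∈-remove⁻ v∈S∖x
  ... | v∈S , v≢x = v∈S , v≢x , v≢y

  length-remove₂ : ∀ {x y S} → Unique S → x ∈ S → y ∈ S → x ≢ y →
                   suc (suc (length (remove₂ x y S))) ≡ length S
  length-remove₂ uS x∈S y∈S x≢y =
    trans (cong suc (length-remove (remove-unique uS) (∈-remove⁺ y∈S (x≢y ∘ sym))))
          (length-remove uS x∈S)

module _ {n : ℕ} (G : Graph n) where
  open Graph G renaming (sym to adj-sym)
  open Removal (_≟_ {n})

  _∈?_ : ∀ (v : Fin n) P → Dec (v ∈ P)
  _∈?_ = member? _≟_

  adj⇒≢ : ∀ {a b} → Adj a b → a ≢ b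
  adj⇒≢ a~b a≡b = irrefl (subst (Adj _) (sym a≡b) a~b)

  no-claw : ClawFree G → ∀ {c a b d} → Adj c a → Adj c b → Adj c d →
            a ≢ b → a ≢ d → b ≢ d → ¬ Adj a b → ¬ Adj a d → ¬ Adj b d → ⊥
  no-claw cf c~a c~b c~d a≢b a≢d b≢d ¬ab ¬ad ¬bd =
    cf (_ , _ , _ , _ , c~a , c~b , c~d , a≢b , a≢d , b≢d , ¬ab , ¬ad , ¬bd)

  InducedEdge : List (Fin n) → Fin n → Fin n → Set
  InducedEdge S a b = Adj a b × a ∈ S × b ∈ S

  Walk : List (Fin n) → Fin n → Fin n → Set
  Walk S = Star (InducedEdge S)

  ConnectedOn : List (Fin n) → Set
  ConnectedOn S = ∀ {a b} → a ∈ S → b ∈ S → Walk S a b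

  walk-reverse : ∀ {S a b} → Walk S a b → Walk S b a
  walk-reverse = Star.reverse (λ (a~b , a∈ , b∈) → adj-sym a~b , b∈ , a∈)

  first-edge : ∀ {S a b} → Walk S a b → a ≢ b → Σ (Fin n) λ c → Adj a c × c ∈ S
  first-edge ε a≢a = ⊥-elim (a≢a refl)
  first-edge ((a~c , _ , c∈S) ◅ _) _ = _ , a~c , c∈S

  walk-from-head : ∀ {T r} R → Linked Adj (r ∷ R) → All (_∈ T) (r ∷ R) →
                   ∀ {a} → a ∈ r ∷ R → Walk T r a
  walk-from-head _ _ _ (here refl) = ε
  walk-from-head [] _ _ (there ())
  walk-from-head (r′ ∷ R) (r~r′ ∷ l) (r∈T ∷ rest@(r′∈T ∷ _)) (there a∈) =
    (r~r′ , r∈T , r′∈T) ◅ walk-from-head R l rest a∈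

  linked-walk : ∀ {T} R → Linked Adj R → All (_∈ T) R → ∀ {a b} → a ∈ R → b ∈ R → Walk T a b
  linked-walk (r ∷ R) l R⊆T a∈ b∈ =
    walk-reverse (walk-from-head R l R⊆T a∈) ◅◅ walk-from-head R l R⊆T b∈

  EndClosed : List (Fin n) → Fin n → Fin n → List (Fin n) → Set
  EndClosed S x y R = ∀ {v} → v ∈ S → Adj y v → v ≡ x ⊎ v ∈ R

  -- No swap-extension within S, witnessed by a vertex w of R adjacent to x
  -- (the vertex before x): if w is adjacent to y, every S-neighbour of x is y or on R.
  SwapClosed : List (Fin n) → Fin n → Fin n → List (Fin n) → Set
  SwapClosed S x y R = R ≡ [] ⊎ Σ (Fin n) λ w → w ∈ R × Adj x w ×
    (Adj w y → ∀ {v} → v ∈ S → Adj x v → v ≡ y ⊎ v ∈ R)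

  record Stuck (S : List (Fin n)) (x y : Fin n) (R : List (Fin n)) : Set where
    field
      x∈S         : x ∈ S
      y∈S         : y ∈ S
      x~y         : Adj x y
      R-path      : Linked Adj R
      R⊆S         : All (_∈ S) R
      x∉R         : x ∉ R
      y∉R         : y ∉ R
      end-closed  : EndClosed S x y R
      swap-closed : SwapClosed S x y R

  module _ (cf : ClawFree G) {S x y R} (cS : ConnectedOn S) (st : Stuck S x y R) where
    open Stuck st

    S′ : List (Fin n)
    S′ = remove₂ x y S

    ∈S′⇒∈S : ∀ {a} → a ∈ S′ → a ∈ S
    ∈S′⇒∈S a∈S′ = proj₁ (∈-remove₂⁻ x y S a∈S′)

    ∈S′⇒≢x : ∀ {a} → a ∈ S′ → a ≢ x
    ∈S′⇒≢x a∈S′ = proj₁ (proj₂ (∈-remove₂⁻ x y S a∈S′))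

    ∈S′⇒≢y : ∀ {a} → a ∈ S′ → a ≢ y
    ∈S′⇒≢y a∈S′ = proj₂ (proj₂ (∈-remove₂⁻ x y S a∈S′))

    R⊆S′ : All (_∈ S′) R
    R⊆S′ = All.tabulate λ a∈R →
      ∈-remove₂⁺ (All.lookup R⊆S a∈R) (λ { refl → x∉R a∈R }) (λ { refl → y∉R a∈R })

    R-walk : ∀ {a b} → a ∈ R → b ∈ R → Walk S′ a b
    R-walk = linked-walk R R-path R⊆S′

    y-neighbour-on-R : ∀ {a} → a ∈ S′ → Adj y a → a ∈ R
    y-neighbour-on-R a∈S′ y~a = [ ⊥-elim ∘ ∈S′⇒≢x a∈S′ , id ] (end-closed (∈S′⇒∈S a∈S′) y~a)

    Anchor : Fin n → Set
    Anchor a = a ∈ S′ × (a ∈ R ⊎ Adj x a)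

    -- Following a walk in S from a ∈ S′ to x, the last vertex before the walk
    -- leaves S′ is an anchor (it precedes x, or precedes y and so lies on R).
    to-anchor : ∀ {a} → a ∈ S′ → Walk S a x → Σ (Fin n) λ a′ → Anchor a′ × Walk S′ a a′
    to-anchor x∈S′ ε = ⊥-elim (∈S′⇒≢x x∈S′ refl)
    to-anchor {a} a∈S′ (_◅_ {j = c} (a~c , _ , c∈S) c⇝x) with c ≟ x | c ≟ y
    ... | yes refl | _ = a , (a∈S′ , inj₂ (adj-sym a~c)) , ε
    ... | no _ | yes refl = a , (a∈S′ , inj₁ (y-neighbour-on-R a∈S′ (adj-sym a~c))) , ε
    ... | no c≢x | no c≢y with to-anchor (∈-remove₂⁺ c∈S c≢x c≢y) c⇝x
    ...   | a′ , anchor , c⇝a′ = a′ , anchor , (a~c , a∈S′ , ∈-remove₂⁺ c∈S c≢x c≢y) ◅ c⇝a′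

    -- If w ∈ R is adjacent to x and satisfies the swap condition, every anchor
    -- reaches w: an anchor a adjacent to x but not to w gives the claw x; y, w, a,
    -- unless w ~ y, when the swap condition puts a on R.
    anchor-to-w : ∀ {w} → w ∈ R → Adj x w →
                  (Adj w y → ∀ {v} → v ∈ S → Adj x v → v ≡ y ⊎ v ∈ R) →
                  ∀ {a} → Anchor a → Walk S′ a w
    anchor-to-w w∈R _ _ (_ , inj₁ a∈R) = R-walk a∈R w∈R
    anchor-to-w {w} w∈R x~w swap {a} (a∈S′ , inj₂ x~a) with a ∈? R | dec a w | dec w y
    ... | yes a∈R | _ | _ = R-walk a∈R w∈R
    ... | no _ | yes a~w | _ = (a~w , a∈S′ , All.lookup R⊆S′ w∈R) ◅ ε
    ... | no a∉R | no _ | yes w~y =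
      ⊥-elim ([ ∈S′⇒≢y a∈S′ , a∉R ] (swap w~y (∈S′⇒∈S a∈S′) x~a))
    ... | no a∉R | no ¬a~w | no ¬w~y =
      ⊥-elim (no-claw cf x~y x~w x~a
        (λ y≡w → ∈S′⇒≢y (All.lookup R⊆S′ w∈R) (sym y≡w))
        (λ y≡a → ∈S′⇒≢y a∈S′ (sym y≡a))
        (λ { refl → a∉R w∈R })
        (¬w~y ∘ adj-sym) (a∉R ∘ y-neighbour-on-R a∈S′) (¬a~w ∘ adj-sym))

    off-empty : R ≡ [] → ∀ {v} → v ∉ R
    off-empty R≡[] = ¬Any[] ∘ subst (_ ∈_) R≡[]

    -- If R is empty, anchors are neighbours of x not adjacent to y, so by
    -- claw-freeness at x any two of them are equal or adjacent.
    anchors-adjacent : R ≡ [] → ∀ {a b} → Anchor a → Anchor b → Walk S′ a b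
    anchors-adjacent R≡[] (_ , inj₁ a∈R) _ = ⊥-elim (off-empty R≡[] a∈R)
    anchors-adjacent R≡[] _ (_ , inj₁ b∈R) = ⊥-elim (off-empty R≡[] b∈R)
    anchors-adjacent R≡[] {a} {b} (a∈S′ , inj₂ x~a) (b∈S′ , inj₂ x~b) with a ≟ b | dec a b
    ... | yes refl | _ = ε
    ... | no _ | yes a~b = (a~b , a∈S′ , b∈S′) ◅ ε
    ... | no a≢b | no ¬a~b =
      ⊥-elim (no-claw cf x~y x~a x~b
        (λ y≡a → ∈S′⇒≢y a∈S′ (sym y≡a))
        (λ y≡b → ∈S′⇒≢y b∈S′ (sym y≡b))
        a≢b
        (off-empty R≡[] ∘ y-neighbour-on-R a∈S′)
        (off-empty R≡[] ∘ y-neighbour-on-R b∈S′)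
        ¬a~b)

    anchors-connected : SwapClosed S x y R → ∀ {a b} → Anchor a → Anchor b → Walk S′ a b
    anchors-connected (inj₁ R≡[]) = anchors-adjacent R≡[]
    anchors-connected (inj₂ (w , w∈R , x~w , swap)) A B =
      anchor-to-w w∈R x~w swap A ◅◅ walk-reverse (anchor-to-w w∈R x~w swap B)

    connected-after-removal : ConnectedOn S′
    connected-after-removal a∈S′ b∈S′
      with to-anchor a∈S′ (cS (∈S′⇒∈S a∈S′) x∈S)
         | to-anchor b∈S′ (cS (∈S′⇒∈S b∈S′) x∈S)
    ... | _ , A , a⇝a′ | _ , B , b⇝b′ =
      a⇝a′ ◅◅ anchors-connected swap-closed A B ◅◅ walk-reverse b⇝b′

  -- A path of the subgraph induced on S, listed from its last vertex.
  PathIn : List (Fin n) → List (Fin n) → Set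
  PathIn S P = Unique P × Linked Adj P × All (_∈ S) P

  neighbour-outside? : ∀ S c P → (Σ (Fin n) λ v → v ∈ S × Adj c v × v ∉ P) ⊎
                                 (∀ {v} → v ∈ S → Adj c v → v ∈ P)
  neighbour-outside? S c P with any? (λ v → dec c v ×-dec ¬? (v ∈? P)) S
  ... | yes found = inj₁ (find found)
  ... | no none = inj₂ λ v∈S c~v → decidable-stable (_ ∈? P) (λ v∉P → none (lose v∈S (c~v , v∉P)))

  swap-closed-of-path : ∀ {S y x} R → Linked Adj (x ∷ R) →
    (∀ {w R′} → R ≡ w ∷ R′ → Adj w y → ∀ {v} → v ∈ S → Adj x v → v ≡ y ⊎ v ∈ R) →
    SwapClosed S x y R
  swap-closed-of-path [] _ _ = inj₁ refl
  swap-closed-of-path (w ∷ R) (x~w ∷ _) swap = inj₂ (w , here refl , x~w , swap refl)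

  stuck-of-path : ∀ {S y x R} → PathIn S (y ∷ x ∷ R) →
                  (∀ {v} → v ∈ S → Adj y v → v ∈ y ∷ x ∷ R) →
                  (∀ {w R′} → R ≡ w ∷ R′ → Adj w y → ∀ {v} → v ∈ S → Adj x v → v ∈ y ∷ x ∷ R) →
                  Stuck S x y R
  stuck-of-path {S} {y} {x} {R} ((y∉ ∷ x∉R ∷ _) , (y~x ∷ xR-path) , (y∈S ∷ x∈S ∷ R⊆S)) end swap =
    record
      { x∈S = x∈S ; y∈S = y∈S ; x~y = adj-sym y~x
      ; R-path = Linked.tail xR-path ; R⊆S = R⊆S
      ; x∉R = All¬⇒¬Any x∉R ; y∉R = All¬⇒¬Any (All.tail y∉)
      ; end-closed = λ v∈S y~v → seen-from-y y~v (end v∈S y~v)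
      ; swap-closed = swap-closed-of-path R xR-path
          (λ R≡wR′ w~y v∈S x~v → seen-from-x x~v (swap R≡wR′ w~y v∈S x~v)) }
    where
    seen-from-y : ∀ {v} → Adj y v → v ∈ y ∷ x ∷ R → v ≡ x ⊎ v ∈ R
    seen-from-y y~y (here refl) = ⊥-elim (irrefl y~y)
    seen-from-y _ (there (here refl)) = inj₁ refl
    seen-from-y _ (there (there v∈R)) = inj₂ v∈R

    seen-from-x : ∀ {v} → Adj x v → v ∈ y ∷ x ∷ R → v ≡ y ⊎ v ∈ R
    seen-from-x _ (here refl) = inj₁ refl
    seen-from-x x~x (there (here refl)) = ⊥-elim (irrefl x~x)
    seen-from-x _ (there (there v∈R)) = inj₂ v∈R

  Longer : List (Fin n) → List (Fin n) → Set
  Longer S R = Σ (Fin n) λ y′ → Σ (Fin n) λ x′ → Σ (List (Fin n)) λ R′ →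
    PathIn S (y′ ∷ x′ ∷ R′) × length R′ ≡ suc (length R)

  swap-or-stuck : ∀ {S y x} R → PathIn S (y ∷ x ∷ R) →
                  (∀ {v} → v ∈ S → Adj y v → v ∈ y ∷ x ∷ R) → Longer S R ⊎ Stuck S x y R
  swap-or-stuck [] p end = inj₂ (stuck-of-path p end (λ ()))
  swap-or-stuck {S} {y} {x} (w ∷ R) p end with dec w y | neighbour-outside? S x (y ∷ x ∷ w ∷ R)
  ... | no ¬w~y | _ = inj₂ (stuck-of-path p end (λ { refl w~y → ⊥-elim (¬w~y w~y) }))
  ... | yes _ | inj₂ swap = inj₂ (stuck-of-path p end (λ _ _ → swap))
  ... | yes w~y | inj₁ (v , v∈S , x~v , v∉P) with p
  ...   | ((y≢x ∷ y≢wR) ∷ x≢wR ∷ uR) , (y~x ∷ x~w ∷ lR) , (y∈S ∷ x∈S ∷ wR⊆S) =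
    inj₁ (v , x , y ∷ w ∷ R
         , ( ¬Any⇒All¬ _ (∉-swap v∉P) ∷ (y≢x ∘ sym ∷ x≢wR) ∷ y≢wR ∷ uR
           , adj-sym x~v ∷ adj-sym y~x ∷ adj-sym w~y ∷ lR
           , v∈S ∷ x∈S ∷ y∈S ∷ wR⊆S)
         , refl)

  extend-or-stuck : ∀ {S y x R} → PathIn S (y ∷ x ∷ R) → Longer S R ⊎ Stuck S x y R
  extend-or-stuck {S} {y} {x} {R} p@(u , l , P⊆S) with neighbour-outside? S y (y ∷ x ∷ R)
  ... | inj₁ (v , v∈S , y~v , v∉P) =
    inj₁ (v , y , x ∷ R , (¬Any⇒All¬ _ v∉P ∷ u , adj-sym y~v ∷ l , v∈S ∷ P⊆S) , refl)
  ... | inj₂ end = swap-or-stuck R p end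

  -- Extending a path while possible ends in a stuck path; the fuel bounds
  -- the number of extensions, since by pigeonhole a path in S has at most
  -- length S vertices.
  stuck-path : ∀ fuel {S y x R} → PathIn S (y ∷ x ∷ R) → length S ≤ fuel + length R →
               Σ (Fin n) λ x′ → Σ (Fin n) λ y′ → Σ (List (Fin n)) λ R′ → Stuck S x′ y′ R′
  stuck-path zero (u , _ , P⊆S) bound =
    ⊥-elim (1+n≰n (≤-trans (n≤1+n _) (≤-trans (unique-⊆-length u P⊆S) bound)))
  stuck-path (suc fuel) {R = R} p bound with extend-or-stuck p
  ... | inj₂ st = _ , _ , _ , st
  ... | inj₁ (_ , _ , R′ , p′ , longer) =
    stuck-path fuel p′ (≤-trans bound (≤-reflexive (begin
      suc (fuel + length R)  ≡⟨ sym (+-suc fuel (length R)) ⟩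
      fuel + suc (length R)  ≡⟨ cong (fuel +_) (sym longer) ⟩
      fuel + length R′       ∎)))
    where open ≡-Reasoning

  stuck-from-edge : ∀ {S a c} → a ∈ S → c ∈ S → Adj a c →
                    Σ (Fin n) λ x → Σ (Fin n) λ y → Σ (List (Fin n)) λ R → Stuck S x y R
  stuck-from-edge {S} a∈S c∈S a~c =
    stuck-path (length S) ((adj⇒≢ (adj-sym a~c) ∷ []) ∷ [] ∷ [] , adj-sym a~c ∷ [-] , c∈S ∷ a∈S ∷ [])
               (≤-reflexive (sym (+-identityʳ (length S))))

  record PerfectMatchingOn (S : List (Fin n)) : Set₁ where
    field
      M       : Fin n → Fin n → Set
      M⊆E     : ∀ {u v} → M u v → Adj u v
      M-sym   : ∀ {u v} → M u v → M v u
      covered : ∀ {u} → u ∈ S → ∃[ v ] M u v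
      unique  : ∀ {u v w} → M u v → M u w → v ≡ w
      support : ∀ {u v} → M u v → u ∈ S

  empty-matching : PerfectMatchingOn []
  empty-matching = record
    { M = λ _ _ → ⊥ ; M⊆E = λ () ; M-sym = λ () ; covered = λ () ; unique = λ () ; support = λ () }

  Edge : Fin n → Fin n → Fin n → Fin n → Set
  Edge x y u v = (u ≡ x × v ≡ y) ⊎ (u ≡ y × v ≡ x)

  edge-unique : ∀ {x y u v w} → x ≢ y → Edge x y u v → Edge x y u w → v ≡ w
  edge-unique _ (inj₁ (_ , v≡y)) (inj₁ (_ , w≡y)) = trans v≡y (sym w≡y)
  edge-unique _ (inj₂ (_ , v≡x)) (inj₂ (_ , w≡x)) = trans v≡x (sym w≡x)
  edge-unique x≢y (inj₁ (u≡x , _)) (inj₂ (u≡y , _)) = ⊥-elim (x≢y (trans (sym u≡x) u≡y))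
  edge-unique x≢y (inj₂ (u≡y , _)) (inj₁ (u≡x , _)) = ⊥-elim (x≢y (trans (sym u≡x) u≡y))

  add-edge : ∀ {S x y} → x ∈ S → y ∈ S → Adj x y → PerfectMatchingOn (remove₂ x y S) →
             Σ (PerfectMatchingOn S) λ PM → PerfectMatchingOn.M PM x y
  add-edge {S} {x} {y} x∈S y∈S x~y PM =
    record { M = M⁺ ; M⊆E = M⁺⊆E ; M-sym = M⁺-sym ; covered = covered⁺
           ; unique = unique⁺ ; support = support⁺ }
    , inj₂ (inj₁ (refl , refl))
    where
    open PerfectMatchingOn PM
    M⁺ : Fin n → Fin n → Set
    M⁺ u v = M u v ⊎ Edge x y u v

    -- the old matching avoids x and y, so it is disjoint from the new edge
    disjoint : ∀ {u v w} → M u v → ¬ Edge x y u w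
    disjoint m (inj₁ (u≡x , _)) = proj₁ (proj₂ (∈-remove₂⁻ x y S (support m))) u≡x
    disjoint m (inj₂ (u≡y , _)) = proj₂ (proj₂ (∈-remove₂⁻ x y S (support m))) u≡y

    M⁺⊆E : ∀ {u v} → M⁺ u v → Adj u v
    M⁺⊆E (inj₁ m) = M⊆E m
    M⁺⊆E (inj₂ (inj₁ (refl , refl))) = x~y
    M⁺⊆E (inj₂ (inj₂ (refl , refl))) = adj-sym x~y

    M⁺-sym : ∀ {u v} → M⁺ u v → M⁺ v u
    M⁺-sym (inj₁ m) = inj₁ (M-sym m)
    M⁺-sym (inj₂ (inj₁ (u≡x , v≡y))) = inj₂ (inj₂ (v≡y , u≡x))
    M⁺-sym (inj₂ (inj₂ (u≡y , v≡x))) = inj₂ (inj₁ (v≡x , u≡y))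

    covered⁺ : ∀ {u} → u ∈ S → ∃[ v ] M⁺ u v
    covered⁺ {u} u∈S with u ≟ x | u ≟ y
    ... | yes u≡x | _ = y , inj₂ (inj₁ (u≡x , refl))
    ... | no _ | yes u≡y = x , inj₂ (inj₂ (u≡y , refl))
    ... | no u≢x | no u≢y with covered (∈-remove₂⁺ u∈S u≢x u≢y)
    ...   | v , m = v , inj₁ m

    unique⁺ : ∀ {u v w} → M⁺ u v → M⁺ u w → v ≡ w
    unique⁺ (inj₁ m) (inj₁ m′) = unique m m′
    unique⁺ (inj₁ m) (inj₂ e) = ⊥-elim (disjoint m e)
    unique⁺ (inj₂ e) (inj₁ m) = ⊥-elim (disjoint m e)
    unique⁺ (inj₂ e) (inj₂ e′) = edge-unique (adj⇒≢ x~y) e e′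

    support⁺ : ∀ {u v} → M⁺ u v → u ∈ S
    support⁺ (inj₁ m) = proj₁ (∈-remove₂⁻ x y S (support m))
    support⁺ (inj₂ (inj₁ (refl , _))) = x∈S
    support⁺ (inj₂ (inj₂ (refl , _))) = y∈S

  -- Inductive step: match the
  -- last edge of a stuck path and recurse on the (still connected) rest.
  mutual
    sumner : ClawFree G → ∀ m {S} → Unique S → length S ≡ m * 2 → ConnectedOn S →
             PerfectMatchingOn S
    sumner cf zero {[]} _ _ _ = empty-matching
    sumner cf zero {_ ∷ _} _ () _
    sumner cf (suc m) {[]} _ () _
    sumner cf (suc m) {_ ∷ []} _ () _
    sumner cf (suc m) {a ∷ b ∷ T} uS@((a≢b ∷ _) ∷ _) len cS
      with first-edge (cS (here refl) (there (here refl))) a≢b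
    ... | c , a~c , c∈S with stuck-from-edge (here refl) c∈S a~c
    ...   | _ , _ , _ , st = proj₁ (match-stuck-edge cf m uS len cS st)

    match-stuck-edge : ClawFree G → ∀ m {S x y R} → Unique S → length S ≡ suc m * 2 →
                       ConnectedOn S → Stuck S x y R →
                       Σ (PerfectMatchingOn S) λ PM → PerfectMatchingOn.M PM x y
    match-stuck-edge cf m uS len cS st =
      add-edge x∈S y∈S x~y
        (sumner cf m (remove-unique (remove-unique uS))
          (suc-injective (suc-injective (trans (length-remove₂ uS x∈S y∈S (adj⇒≢ x~y)) len)))
          (connected-after-removal cf cS st))
      where open Stuck st

  connected-on-all : Connected G → ConnectedOn (allFin n)
  connected-on-all conn {a} {b} _ _ =
    Star.map (λ {u} {v} u~v → u~v , ∈-allFin u , ∈-allFin v) (conn a b)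

  perfect-matching-of : PerfectMatchingOn (allFin n) → PerfectMatching G
  perfect-matching-of PM = record
    { M = M ; M⊆E = M⊆E ; M-sym = M-sym ; covered = λ u → covered (∈-allFin u) ; unique = unique }
    where open PerfectMatchingOn PM

  end-closed-of : ∀ ps {x y} → ¬ EndExtension G (ps ++ x ∷ y ∷ []) y → EndClosed (allFin n) x y ps
  end-closed-of ps {x} {y} no-end with neighbour-outside? (allFin n) y (ps ++ x ∷ y ∷ [])
  ... | inj₁ (v , _ , y~v , v∉P) = ⊥-elim (no-end (v , y~v , v∉P))
  ... | inj₂ on-path = λ v∈ y~v →
    [ inj₂ , [ inj₁ , (λ v≡y → ⊥-elim (adj⇒≢ y~v (sym v≡y))) ] ]′ (∈-path⁻ ps (on-path v∈ y~v))

  swap-closed-of : ∀ ps {x y} → Linked Adj (ps ++ x ∷ y ∷ []) → ¬ SwapExtension G ps x y →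
                   SwapClosed (allFin n) x y ps
  swap-closed-of ps l no-swap with initLast ps
  ... | [] = inj₁ refl
  swap-closed-of .(qs ∷ʳ w) {x} {y} l no-swap | qs ∷ʳ′ w =
    inj₂ (w , ∈-++⁺ʳ qs (here refl) , adj-sym w~x , closed)
    where
    w~x : Adj w x
    w~x = linked-at qs (subst (Linked Adj) (++-assoc qs (w ∷ []) (x ∷ y ∷ [])) l)

    closed : Adj w y → ∀ {v} → v ∈ allFin n → Adj x v → v ≡ y ⊎ v ∈ qs ∷ʳ w
    closed w~y with neighbour-outside? (allFin n) x ((qs ∷ʳ w) ++ x ∷ y ∷ [])
    ... | inj₁ (v , _ , x~v , v∉P) = ⊥-elim (no-swap (qs , w , refl , w~y , v , x~v , v∉P))
    ... | inj₂ on-path = λ v∈ x~v →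
      [ inj₂ , [ (λ v≡x → ⊥-elim (adj⇒≢ x~v (sym v≡x))) , inj₁ ]′ ]′ (∈-path⁻ (qs ∷ʳ w) (on-path v∈ x~v))

  stuck-of-unextendable : ∀ ps {x y} → IsPath G (ps ++ x ∷ y ∷ []) →
                          ¬ EndExtension G (ps ++ x ∷ y ∷ []) y → ¬ SwapExtension G ps x y →
                          Stuck (allFin n) x y ps
  stuck-of-unextendable ps {x} {y} (u , l) no-end no-swap = record
    { x∈S = ∈-allFin x ; y∈S = ∈-allFin y ; x~y = linked-at ps l
    ; R-path = linked-prefix ps l ; R⊆S = All.tabulate (λ {v} _ → ∈-allFin v)
    ; x∉R = λ x∈ps → unique-++-disjoint ps u x∈ps (here refl)
    ; y∉R = λ y∈ps → unique-++-disjoint ps u y∈ps (there (here refl))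
    ; end-closed = end-closed-of ps no-end
    ; swap-closed = swap-closed-of ps l no-swap }

lemma3 : (n : ℕ) (G : Graph n) → Connected G → ClawFree G → 2 ∣ n →
    (ps : List (Fin n)) (x y : Fin n) →
    IsPath G (ps ++ x ∷ y ∷ []) →
    ¬ EndExtension G (ps ++ x ∷ y ∷ []) y →
    ¬ SwapExtension G ps x y →
    Σ (PerfectMatching G) λ PM → PerfectMatching.M PM x y
lemma3 n G conn cf (divides q n≡q*2) ps x y path no-end no-swap = matching q n≡q*2
  where
  stuck : Stuck G (allFin n) x y ps
  stuck = stuck-of-unextendable G ps path no-end no-swap

  matching : ∀ q → n ≡ q * 2 → Σ (PerfectMatching G) λ PM → PerfectMatching.M PM x y
  matching zero n≡0 = ⊥-elim (¬Fin0 (subst Fin n≡0 x))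
  matching (suc m) n≡2+2m
    with match-stuck-edge G cf m (allFin⁺ n) (trans (length-tabulate id) n≡2+2m)
                          (connected-on-all G conn) stuck
  ... | PM , x~ₘy = perfect-matching-of G PM , x~ₘy
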